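{- For all functions $\kappa,\kappa':\mathbb{N}\to\mathbb{N}$ and all $n\in\mathbb{N}$, $(\kappa\circ\kappa')|_n=(\kappa|_n)\circ(\kappa'|_{L(\kappa,n)})$.
   Context: Untyped modal transformations are functions $\kappa:\mathbb{N}\to\mathbb{N}$. Truncation: $(\kappa|_n)(m)=\kappa(n+m)$. Truncation offset: $L(\kappa,0)=0$, $L(\kappa,1+n)=\kappa(0)+L(\kappa|_1,n)$. Composition (not ordinary function composition) is defined by $(\kappa\circ\kappa')(0)=L(\kappa',\kappa(0))$ and $(\kappa\circ\kappa')(1+n)=((\kappa|_1)\circ(\kappa'|_{\kappa(0)}))(n)$ (by recursion on the argument). -}

module Defs where

open import Data.Nat using (ℕ; zero; suc; _+_)

MT : Set
MT = ℕ → ℕ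

_|ₜ_ : MT → ℕ → MT
(κ |ₜ n) m = κ (n + m)

L : MT → ℕ → ℕ
L κ zero    = 0
L κ (suc n) = κ 0 + L (κ |ₜ 1) n

_⊚_ : MT → MT → MT
(κ ⊚ κ') zero    = L κ' (κ 0)
(κ ⊚ κ') (suc n) = ((κ |ₜ 1) ⊚ (κ' |ₜ κ 0)) n

-- Truncating by suc n is truncating the composite by 1 and then by n,
-- and (κ ⊚ κ') |ₜ 1 is definitionally (κ |ₜ 1) ⊚ (κ' |ₜ κ 0); the offsets then match
-- because L κ (suc n) = κ 0 + L (κ |ₜ 1) n. Since the operations are not
-- definitionally extensional, we first show they respect pointwise equality.

{-# OPTIONS --safe #-}
module Submission where

open import Defs
open import Data.Nat using (ℕ; zero; suc; _+_)
open import Data.Nat.Properties using (+-assoc)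
open import Relation.Binary.PropositionalEquality
  using (_≡_; _≗_; refl; cong; cong₂; sym; trans)

|ₜ-cong : ∀ {κ ι} → κ ≗ ι → ∀ n → (κ |ₜ n) ≗ (ι |ₜ n)
|ₜ-cong eq n m = eq (n + m)

L-cong : ∀ {κ ι} → κ ≗ ι → ∀ n → L κ n ≡ L ι n
L-cong eq zero    = refl
L-cong eq (suc n) = cong₂ _+_ (eq 0) (L-cong (|ₜ-cong eq 1) n)

⊚-cong : ∀ {κ ι κ' ι'} → κ ≗ ι → κ' ≗ ι' → (κ ⊚ κ') ≗ (ι ⊚ ι')
⊚-cong {κ} {ι} {κ'} {ι'} eq eq' zero = trans (L-cong eq' (κ 0)) (cong (L ι') (eq 0))
⊚-cong {κ} {ι} {κ'} {ι'} eq eq' (suc m) = ⊚-cong (|ₜ-cong eq 1) eq'-shifted m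
  where
  eq'-shifted : (κ' |ₜ κ 0) ≗ (ι' |ₜ ι 0)
  eq'-shifted x = trans (eq' (κ 0 + x)) (cong (λ k → ι' (k + x)) (eq 0))

|ₜ-|ₜ : ∀ κ a b → ((κ |ₜ a) |ₜ b) ≗ (κ |ₜ (a + b))
|ₜ-|ₜ κ a b x = cong κ (sym (+-assoc a b x))

lemma6p9 : (κ κ' : MT) (n m : ℕ) →
    ((κ ⊚ κ') |ₜ n) m ≡ ((κ |ₜ n) ⊚ (κ' |ₜ L κ n)) m
lemma6p9 κ κ' zero    m = ⊚-cong (λ _ → refl) (λ _ → refl) m
lemma6p9 κ κ' (suc n) m =
  trans (lemma6p9 (κ |ₜ 1) (κ' |ₜ κ 0) n m)
        (⊚-cong (λ _ → refl) (|ₜ-|ₜ κ' (κ 0) (L (κ |ₜ 1) n)) m)
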